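{- For $n\ge 1$, let $Z_{n+1}=(\mathsf{N}\mathsf{E})^{n+1}\in\mathcal{D}_{n+1}$. Then $\mathsf{traj}(Z_{n+1})$ is odd if $n\equiv 0,1\pmod 4$ and even if $n\equiv 2,3\pmod 4$.
   Context: A Dyck path of size $n$ is a lattice path in $\mathbb{Z}^2$ from $(0,0)$ to $(n,n)$ using steps $\mathsf{N}=(0,1)$ and $\mathsf{E}=(1,0)$ that never goes below $y=x$; $\mathcal{D}_n$ is the set of such paths. For a Dyck path $P$, $-P$ is its reflection over $y=x$. For $P,Q\in\mathcal{D}_n$, the grid polygon associated with $(P,Q)$ is the region enclosed by $P$ and $-Q$; its boundary consists of the $4n$ unit steps of $P$ and $-Q$. From the midpoint of any boundary step, emit a light beam into the interior making a $45^\circ$ angle with that step; it travels straight until it reaches the midpoint of another boundary step (meeting it at $45^\circ$). This defines a permutation of the $4n$ boundary steps; $\mathsf{traj}(P,Q)$ is its number of cycles. For $P\in\mathcal{D}_n$, $\mathsf{traj}(P)=\mathsf{traj}(P,\mathsf{N}^n\mathsf{E}^n)$. -}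

module Defs where

open import Data.Bool using (Bool; true; false; if_then_else_; _∧_)
open import Data.Nat using (ℕ; zero; suc; _+_; _*_; _≤ᵇ_; _<ᵇ_; _≡ᵇ_; ⌊_/2⌋)
open import Data.Integer as ℤ using (ℤ; +_; -[1+_])
open import Data.Product using (Σ; _×_; _,_; proj₁; proj₂)
open import Data.List using (List; []; _∷_; _++_; length; map; replicate; concat; filterᵇ; upTo; concatMap; deduplicateᵇ)
open import Data.Bool.ListAction using (and)
open import Data.Unit using (⊤; tt)
open import Data.Empty using (⊥)
open import Relation.Nullary using (does)
open import Relation.Nullary.Decidable using (yes; no)
open import Relation.Binary.PropositionalEquality using (_≡_; refl; subst)
import Data.Nat.Properties

data Step : Set where
  N E : Step

Path : Set
Path = List Step

-- prefix condition: starting with surplus k = (#N - #E), never dip below 0,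
-- and end with surplus 0
DyckFrom : ℕ → Path → Set
DyckFrom k []      = k ≡ 0
DyckFrom k (N ∷ p) = DyckFrom (suc k) p
DyckFrom k (E ∷ p) = DyckE k p
  where
  DyckE : ℕ → Path → Set
  DyckE zero    p = ⊥
  DyckE (suc k) p = DyckFrom k p

-- P ∈ 𝒟_n : a path from (0,0) to (n,n) never going below y = x
IsDyck : ℕ → Path → Set
IsDyck n p = (length p ≡ n + n) × DyckFrom 0 p

record Dyck (n : ℕ) : Set where
  constructor dyck
  field
    path    : Path
    isDyck  : IsDyck n path

flip : Step → Step
flip N = E
flip E = N

reflect : Path → Path
reflect = map flip

-- height of the E-step of a path in column i (number of N steps before
-- the (i+1)-st E step)
colHeight : Path → ℕ → ℕ
colHeight []      i       = 0
colHeight (N ∷ p) i       = suc (colHeight p i)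
colHeight (E ∷ p) zero    = 0
colHeight (E ∷ p) (suc i) = colHeight p i

-- unit cell [i,i+1]×[j,j+1] lies inside the region between P (above)
-- and -Q (below)
insideCell : Path → Path → ℕ → ℕ → Bool
insideCell P Q i j = (colHeight (reflect Q) i ≤ᵇ j) ∧ (j <ᵇ colHeight P i)

-- same, for a cell given by its centre in doubled coordinates (odd, odd)
insideCentre : Path → Path → ℤ → ℤ → Bool
insideCentre P Q (+ a)    (+ b)    = insideCell P Q ⌊ a /2⌋ ⌊ b /2⌋
insideCentre P Q (+ a)    -[1+ _ ] = false
insideCentre P Q -[1+ _ ] _        = false

-- All geometry is in doubled coordinates: lattice point (x,y) is (2x,2y),
-- midpoint of a horizontal unit step is (odd, even), of a vertical one
-- (even, odd).  Directions of the 45° beams are (±1, ±1).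

Pt : Set
Pt = ℤ × ℤ

record BStep : Set where
  constructor bstep
  field
    mid   : Pt
    horiz : Bool

edgesFrom : ℕ → ℕ → Path → List (ℕ × ℕ × Step)
edgesFrom x y []      = []
edgesFrom x y (N ∷ p) = (x , y , N) ∷ edgesFrom x (suc y) p
edgesFrom x y (E ∷ p) = (x , y , E) ∷ edgesFrom (suc x) y p

mkB : ℕ × ℕ × Step → BStep
mkB (x , y , E) = bstep (+ (suc (2 * x)) , + (2 * y)) true
mkB (x , y , N) = bstep (+ (2 * x) , + (suc (2 * y))) false

boundary : Path → Path → List BStep
boundary P Q = map mkB (edgesFrom 0 0 (reflect Q)) ++ map mkB (edgesFrom 0 0 P)

-- centre (doubled coordinates) of the unit cell entered when leaving the
-- midpoint p of a step (horizontal iff h) in diagonal direction (dx,dy)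
cellAhead : Pt → Pt → Bool → Pt
cellAhead (x , y) (dx , dy) h = if h then (x , y ℤ.+ dy) else (x ℤ.+ dx , y)

diagonals : List Pt
diagonals = (+ 1 , + 1) ∷ (-[1+ 0 ] , + 1) ∷ (+ 1 , -[1+ 0 ]) ∷ (-[1+ 0 ] , -[1+ 0 ]) ∷ []

-- the directions making a 45° angle with the step and pointing into the
-- interior (i.e. the first cell crossed lies in the polygon)
inwardDirs : Path → Path → BStep → List Pt
inwardDirs P Q (bstep p h) =
  filterᵇ (λ d → let c = cellAhead p d h in insideCentre P Q (proj₁ c) (proj₂ c)) diagonals

-- Propagate a beam sitting at an edge midpoint p (horizontal edge iff h),
-- heading in direction d into an interior cell: it crosses that cell and
-- reaches the midpoint q of an adjacent edge of it; if the cell beyond q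
-- is still interior the beam continues, otherwise q is the midpoint of a
-- boundary step and the beam stops there.  The fuel bounds the number of
-- cells crossed (a straight 45° segment inside an n×n box crosses at most
-- n cells, and the fuel is 4n+1).
shoot : ℕ → Path → Path → Pt → Pt → Bool → Pt
shoot zero    P Q p       d         h = p
shoot (suc k) P Q (x , y) (dx , dy) h =
  let q  = (x ℤ.+ dx , y ℤ.+ dy)
      h' = if h then false else true
      c  = cellAhead q (dx , dy) h'
  in if insideCentre P Q (proj₁ c) (proj₂ c)
     then shoot k P Q q (dx , dy) h'
     else q

_≟pt_ : Pt → Pt → Bool
(a , b) ≟pt (c , d) = does (a ℤ.≟ c) ∧ does (b ℤ.≟ d)

indexOf : Pt → List BStep → ℕ
indexOf q []       = 0
indexOf q (b ∷ bs) = if q ≟pt BStep.mid b then 0 else suc (indexOf q bs)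

nth : List BStep → ℕ → BStep
nth []       i       = bstep (+ 0 , + 0) true
nth (b ∷ bs) zero    = b
nth (b ∷ bs) (suc i) = nth bs i

beamTargets : Path → Path → ℕ → List ℕ
beamTargets P Q i =
  let bs   = boundary P Q
      b    = nth bs i
      fuel = length P + length Q + 1
  in map (λ d → indexOf (shoot fuel P Q (BStep.mid b) d (BStep.horiz b)) bs)
         (inwardDirs P Q b)

reach : (ℕ → List ℕ) → ℕ → ℕ → List ℕ
reach nb zero    i = i ∷ []
reach nb (suc k) i = let R = reach nb k i in deduplicateᵇ _≡ᵇ_ (R ++ concatMap nb R)

-- number of connected components of the graph on {0,…,m-1} with
-- neighbourhoods nb: the number of i that are the least element of the
-- set of vertices reachable from i
numComponents : ℕ → (ℕ → List ℕ) → ℕ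
numComponents m nb =
  length (filterᵇ (λ i → and (map (λ j → i ≤ᵇ j) (reach nb m i))) (upTo m))

-- traj(P,Q): the number of cycles of the light-beam permutation = the
-- number of closed light trajectories = the number of connected components
-- of the (2-regular) graph joining each boundary step to the steps hit by
-- its two 45° beams
trajPaths : Path → Path → ℕ
trajPaths P Q = numComponents (length (boundary P Q)) (beamTargets P Q)

traj₂ : {n : ℕ} → Dyck n → Dyck n → ℕ
traj₂ (dyck P _) (dyck Q _) = trajPaths P Q

NnEn : ℕ → Path
NnEn n = replicate n N ++ replicate n E

ZPath : ℕ → Path
ZPath n = concat (replicate n (N ∷ E ∷ []))

ZDyck : (n : ℕ) → DyckFrom 0 (ZPath n)
ZDyck zero    = refl
ZDyck (suc n) = ZDyck n

ZLen : (n : ℕ) → length (ZPath n) ≡ n + n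
ZLen zero    = refl
ZLen (suc n) rewrite ZLen n | Data.Nat.Properties.+-suc n n = refl

NnEnDyck : (n : ℕ) → IsDyck n (NnEn n)
NnEnDyck n = len n , subst (λ t → DyckFrom 0 (replicate n N ++ replicate t E)) (Data.Nat.Properties.+-identityʳ n) (go n 0)
  where
  open import Data.List.Properties using (length-++; length-replicate)
  len : (n : ℕ) → length (NnEn n) ≡ n + n
  len n rewrite length-++ (replicate n N) {replicate n E} | length-replicate n {N} | length-replicate n {E} = refl
  goE : (m : ℕ) → DyckFrom m (replicate m E)
  goE zero = refl
  goE (suc m) = goE m
  go : (m k : ℕ) → DyckFrom k (replicate m N ++ replicate (m + k) E)
  go zero k = goE k
  go (suc m) k = subst (λ t → DyckFrom (suc k) (replicate m N ++ replicate t E)) (Data.Nat.Properties.+-suc m k) (go m (suc k))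

Z : (n : ℕ) → Dyck n
Z n = dyck (ZPath n) (ZLen n , ZDyck n)

traj : {n : ℕ} → Dyck n → ℕ
traj {n} P = traj₂ P (dyck (NnEn n) (NnEnDyck n))

module Submission where

-- The polygon of Z_m = (NE)^m and N^m E^m consists of the cells (i, j) with
-- j ≤ i < m: a right triangle whose hypotenuse is a staircase.  Number the
-- outer steps 0, …, 2m−1 along the bottom and then up the right side, and the
-- staircase steps 0, …, 2m−1 from the origin.  Following the beams, outer step
-- p is joined to staircase step p and to the facing outer step 2m−1−p, and
-- staircase steps 2k and 2k+1 are joined to each other.  So a cycle visits
-- exactly the steps at the positions of a pair {2q, 2q+1} and of its mirror
-- pair {2q′, 2q′+1}, q + q′ = m−1, and its least step is the bottom step 2q
-- with q ≤ q′.  Hence traj(Z_m) = ⌈m/2⌉, which is odd iff m−1 ≡ 0, 1 (mod 4).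

open import Defs
open import Data.Bool using (Bool; true; false; if_then_else_; _∧_; not; T)
open import Data.Bool.Properties using (T-≡; T-∧; ∧-zeroʳ)
open import Data.Bool.ListAction using (all)
open import Data.Nat
  using (ℕ; zero; suc; _+_; _*_; _≤_; _<_; z≤n; s≤s; z<s; _≤′_; ≤′-refl; ≤′-step; _≤ᵇ_; _<ᵇ_; _≡ᵇ_; _<?_; _%_; ⌊_/2⌋; ⌈_/2⌉)
open import Data.Nat.Properties
open import Data.Integer as ℤ using (+_; -[1+_])
open import Data.Product using (∃; ∃-syntax; _×_; _,_; proj₁; proj₂)
open import Data.Sum using (_⊎_; inj₁; inj₂)
import Data.Sum
open import Data.List using (List; []; _∷_; _++_; [_]; length; replicate; map; concatMap; filterᵇ; upTo; deduplicateᵇ)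
open import Data.List.Properties using (upTo-∷ʳ; filter-++; length-++; length-map; map-++; map-replicate)
open import Data.List.Membership.Propositional using (_∈_; find; lose)
open import Data.List.Membership.Propositional.Properties
  using (∈-++⁺ˡ; ∈-++⁺ʳ; ∈-++⁻; ∈-concatMap⁺; ∈-concatMap⁻; ∈-deduplicate⁻)
import Data.List.Membership.Setoid.Properties as SetoidMembership
open import Data.List.Relation.Unary.Any using (here; there)
import Data.List.Relation.Unary.All as All
open import Data.List.Relation.Unary.All.Properties using (all⁺; all⁻)
open import Function using (_∘_; Equivalence)
open import Relation.Nullary using (¬_; contradiction; yes; no)
open import Relation.Nullary.Decidable using (T?; dec-true)
open import Relation.Binary.PropositionalEquality
  using (_≡_; _≢_; refl; sym; trans; cong; cong₂; subst; subst₂; setoid; module ≡-Reasoning)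

double : ℕ → ℕ
double zero    = zero
double (suc n) = suc (suc (double n))

double≡+ : ∀ n → double n ≡ n + n
double≡+ zero    = refl
double≡+ (suc n) = cong suc (trans (cong suc (double≡+ n)) (sym (+-suc n n)))

2*≡double : ∀ n → 2 * n ≡ double n
2*≡double n = trans (cong (_+_ n) (+-identityʳ n)) (sym (double≡+ n))

⌊double/2⌋ : ∀ n → ⌊ double n /2⌋ ≡ n
⌊double/2⌋ zero    = refl
⌊double/2⌋ (suc n) = cong suc (⌊double/2⌋ n)

⌊suc-double/2⌋ : ∀ n → ⌊ suc (double n) /2⌋ ≡ n
⌊suc-double/2⌋ zero    = refl
⌊suc-double/2⌋ (suc n) = cong suc (⌊suc-double/2⌋ n)

data Parity : ℕ → Set where
  even : ∀ k → Parity (double k)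
  odd  : ∀ k → Parity (suc (double k))

parity : ∀ n → Parity n
parity zero = even 0
parity (suc n) with parity n
... | even k = odd k
... | odd k  = even (suc k)

double≢suc-double : ∀ a b → double a ≢ suc (double b)
double≢suc-double (suc a) (suc b) e = double≢suc-double a b (suc-injective (suc-injective e))

double-cancel-< : ∀ {a b} → double a < double b → a < b
double-cancel-< {zero}  {suc b} _               = z<s
double-cancel-< {suc a} {suc b} (s≤s (s≤s a<b)) = s≤s (double-cancel-< a<b)

double-mono-< : ∀ {a b} → a < b → suc (double a) < double b
double-mono-< {zero}  {suc b} _         = s≤s (s≤s z≤n)
double-mono-< {suc a} {suc b} (s≤s a<b) = s≤s (s≤s (double-mono-< a<b))

n≤double : ∀ n → n ≤ double n
n≤double n = subst (n ≤_) (sym (double≡+ n)) (m≤m+n n n)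

double-≤ : ∀ {q} p → q ≤ ⌊ p /2⌋ → double q ≤ p
double-≤ {zero}  p             _         = z≤n
double-≤ {suc q} (suc (suc p)) (s≤s q≤) = s≤s (s≤s (double-≤ p q≤))

<-double : ∀ {m} p → ⌊ p /2⌋ < m → p < double m
<-double {suc m} zero          _           = z<s
<-double {suc m} (suc zero)    _           = s≤s z<s
<-double {suc m} (suc (suc p)) (s≤s p/2<m) = s≤s (s≤s (<-double p p/2<m))

⌊/2⌋-mirror : ∀ {m} p p′ → p + suc p′ ≡ double m → ⌊ p /2⌋ + suc ⌊ p′ /2⌋ ≡ m
⌊/2⌋-mirror {zero}  zero          p′ ()
⌊/2⌋-mirror {zero}  (suc p)       p′ ()
⌊/2⌋-mirror {suc m} zero          p′ e = cong suc (trans (cong ⌊_/2⌋ (suc-injective e)) (⌊suc-double/2⌋ m))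
⌊/2⌋-mirror {suc m} (suc zero)    p′ e = cong suc (trans (cong ⌊_/2⌋ (suc-injective (suc-injective e))) (⌊double/2⌋ m))
⌊/2⌋-mirror {suc m} (suc (suc p)) p′ e = cong suc (⌊/2⌋-mirror p p′ (suc-injective (suc-injective e)))

+-suc-comm : ∀ a b → a + suc b ≡ b + suc a
+-suc-comm a b = trans (+-suc a b) (trans (cong suc (+-comm a b)) (sym (+-suc b a)))

<⇒∃+suc : ∀ {a b} → a < b → ∃[ c ] a + suc c ≡ b
<⇒∃+suc a<b with m≤n⇒∃[o]m+o≡n a<b
... | c , e = c , trans (+-suc _ c) e

-- Components of a graph and counting

¬T⇒≡false : ∀ {b} → ¬ T b → b ≡ false
¬T⇒≡false {false} _  = refl
¬T⇒≡false {true}  ¬t = contradiction _ ¬t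

-- numComponents M nb unfolds to count (leastInComponent nb M) M.
leastInComponent : (ℕ → List ℕ) → ℕ → ℕ → Bool
leastInComponent nb M i = all (i ≤ᵇ_) (reach nb M i)

∈-deduplicateᵇ⁺ : ∀ {xs : List ℕ} {z} → z ∈ xs → z ∈ deduplicateᵇ _≡ᵇ_ xs
∈-deduplicateᵇ⁺ = SetoidMembership.∈-deduplicate⁺ (setoid ℕ) (λ x y → T? (x ≡ᵇ y))
                    (λ z≡ᵇy x≡y → trans x≡y (sym (≡ᵇ⇒≡ _ _ z≡ᵇy)))

module Reach (nb : ℕ → List ℕ) where

  reach-refl : ∀ k i → i ∈ reach nb k i
  reach-refl zero    i = here refl
  reach-refl (suc k) i = ∈-deduplicateᵇ⁺ (∈-++⁺ˡ (reach-refl k i))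

  reach-suc : ∀ k {i x} → x ∈ reach nb k i → x ∈ reach nb (suc k) i
  reach-suc k x∈ = ∈-deduplicateᵇ⁺ (∈-++⁺ˡ x∈)

  reach-mono : ∀ {k l i x} → k ≤ l → x ∈ reach nb k i → x ∈ reach nb l i
  reach-mono {k} {l} {i} {x} k≤l = go (≤⇒≤′ k≤l)
    where
    go : ∀ {l} → k ≤′ l → x ∈ reach nb k i → x ∈ reach nb l i
    go               ≤′-refl        x∈ = x∈
    go {l = suc l} (≤′-step k≤′l) x∈ = reach-suc l (go k≤′l x∈)

  reach-step : ∀ k {i x y} → x ∈ reach nb k i → y ∈ nb x → y ∈ reach nb (suc k) i
  reach-step k {i} x∈ y∈ = ∈-deduplicateᵇ⁺ (∈-++⁺ʳ (reach nb k i) (∈-concatMap⁺ nb (lose x∈ y∈)))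

  reach-closed : (C : ℕ → Set) → (∀ {x y} → C x → y ∈ nb x → C y) →
                 ∀ {k i x} → C i → x ∈ reach nb k i → C x
  reach-closed C closed {zero}  Ci (here refl) = Ci
  reach-closed C closed {suc k} {i} Ci x∈
    with ∈-++⁻ (reach nb k i)
               (∈-deduplicate⁻ (λ x y → T? (x ≡ᵇ y)) (reach nb k i ++ concatMap nb (reach nb k i)) x∈)
  ... | inj₁ x∈ʳ = reach-closed C closed {k} Ci x∈ʳ
  ... | inj₂ x∈ⁿ with find (∈-concatMap⁻ nb {xs = reach nb k i} x∈ⁿ)
  ... | y , y∈ , x∈nb = closed (reach-closed C closed {k} Ci y∈) x∈nb


  least-if-closed : ∀ (C : ℕ → Set) → (∀ {x y} → C x → y ∈ nb x → C y) →
                    ∀ {M i} → C i → (∀ {x} → C x → i ≤ x) → leastInComponent nb M i ≡ true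
  least-if-closed C closed {M} {i} Ci bound =
    Equivalence.to T-≡ (all⁻ (i ≤ᵇ_) (All.tabulate (≤⇒≤ᵇ ∘ bound ∘ reach-closed C closed {M} Ci)))

  not-least : ∀ {M i x} → x ∈ reach nb M i → x < i → leastInComponent nb M i ≡ false
  not-least {M} {i} x∈ x<i =
    ¬T⇒≡false (λ least → <⇒≱ x<i (≤ᵇ⇒≤ i _ (All.lookup (all⁺ (i ≤ᵇ_) (reach nb M i) least) x∈)))

count : (ℕ → Bool) → ℕ → ℕ
count f M = length (filterᵇ f (upTo M))

indicator : Bool → ℕ
indicator b = if b then 1 else 0

count-suc : ∀ f M → count f (suc M) ≡ count f M + indicator (f M)
count-suc f M = begin
  length (filterᵇ f (upTo (suc M)))               ≡⟨ cong (length ∘ filterᵇ f) (upTo-∷ʳ M) ⟨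
  length (filterᵇ f (upTo M ++ [ M ]))             ≡⟨ cong length (filter-++ (T? ∘ f) (upTo M) [ M ]) ⟩
  length (filterᵇ f (upTo M) ++ filterᵇ f [ M ])   ≡⟨ length-++ (filterᵇ f (upTo M)) ⟩
  count f M + length (filterᵇ f [ M ])             ≡⟨ cong (_+_ (count f M)) (length-filterᵇ-[ M ]) ⟩
  count f M + indicator (f M)                      ∎
  where
  open ≡-Reasoning
  length-filterᵇ-[_] : ∀ x → length (filterᵇ f [ x ]) ≡ indicator (f x)
  length-filterᵇ-[ x ] with f x
  ... | true  = refl
  ... | false = refl

count-cong : ∀ {f g} M → (∀ {i} → i < M → f i ≡ g i) → count f M ≡ count g M
count-cong {f} {g} zero    f≗g = refl
count-cong {f} {g} (suc M) f≗g = begin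
  count f (suc M)              ≡⟨ count-suc f M ⟩
  count f M + indicator (f M)  ≡⟨ cong₂ (λ c b → c + indicator b) (count-cong M (f≗g ∘ m<n⇒m<1+n)) (f≗g ≤-refl) ⟩
  count g M + indicator (g M)  ≡⟨ count-suc g M ⟨
  count g (suc M)              ∎
  where open ≡-Reasoning

count-beyond : ∀ f M t → (∀ {i} → M ≤ i → f i ≡ false) → count f (M + t) ≡ count f M
count-beyond f M zero    f≡false = cong (count f) (+-identityʳ M)
count-beyond f M (suc t) f≡false = begin
  count f (M + suc t)                    ≡⟨ cong (count f) (+-suc M t) ⟩
  count f (suc (M + t))                  ≡⟨ count-suc f (M + t) ⟩
  count f (M + t) + indicator (f (M + t)) ≡⟨ cong (λ b → count f (M + t) + indicator b) (f≡false (m≤m+n M t)) ⟩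
  count f (M + t) + 0                    ≡⟨ +-identityʳ _ ⟩
  count f (M + t)                        ≡⟨ count-beyond f M t f≡false ⟩
  count f M                              ∎
  where open ≡-Reasoning

isEven : ℕ → Bool
isEven zero    = true
isEven (suc n) = not (isEven n)

isEven-double : ∀ k → isEven (double k) ≡ true
isEven-double zero    = refl
isEven-double (suc k) = cong (not ∘ not) (isEven-double k)

indicator-+-not : ∀ b → indicator b + indicator (not b) ≡ 1
indicator-+-not true  = refl
indicator-+-not false = refl

count-isEven : ∀ M → count isEven M ≡ ⌈ M /2⌉
count-isEven zero          = refl
count-isEven (suc zero)    = refl
count-isEven (suc (suc M)) = begin
  count isEven (suc (suc M))                  ≡⟨ count-suc isEven (suc M) ⟩
  count isEven (suc M) + indicator (not b)    ≡⟨ cong (_+ indicator (not b)) (count-suc isEven M) ⟩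
  count isEven M + indicator b + indicator (not b)    ≡⟨ +-assoc (count isEven M) _ _ ⟩
  count isEven M + (indicator b + indicator (not b))  ≡⟨ cong (_+_ (count isEven M)) (indicator-+-not b) ⟩
  count isEven M + 1                          ≡⟨ cong (_+ 1) (count-isEven M) ⟩
  ⌈ M /2⌉ + 1                                 ≡⟨ +-comm ⌈ M /2⌉ 1 ⟩
  ⌈ suc (suc M) /2⌉                           ∎
  where
  open ≡-Reasoning
  b : Bool
  b = isEven M

≟pt-refl : ∀ p → (p ≟pt p) ≡ true
≟pt-refl (a , b) = cong₂ _∧_ (dec-true (a ℤ.≟ a) refl) (dec-true (b ℤ.≟ b) refl)

≟pt-sound : ∀ {p q} → (p ≟pt q) ≡ true → p ≡ q
≟pt-sound {a , b} {c , d} eq with a ℤ.≟ c | b ℤ.≟ d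
≟pt-sound _  | yes refl | yes refl = refl
≟pt-sound () | yes _    | no _
≟pt-sound () | no _     | _

indexOf-nth : ∀ bs → (∀ {i j} → i < length bs → j < length bs →
                        BStep.mid (nth bs i) ≡ BStep.mid (nth bs j) → i ≡ j) →
              ∀ {i} → i < length bs → indexOf (BStep.mid (nth bs i)) bs ≡ i
indexOf-nth (b ∷ bs) injective {zero}  _ = cong (if_then 0 else suc (indexOf (BStep.mid b) bs)) (≟pt-refl (BStep.mid b))
indexOf-nth (b ∷ bs) injective {suc i} (s≤s i<) with BStep.mid (nth bs i) ≟pt BStep.mid b in eq
... | true  = contradiction (injective (s≤s i<) z<s (≟pt-sound eq)) λ ()
... | false = cong suc (indexOf-nth bs (λ i< j< e → suc-injective (injective (s≤s i<) (s≤s j<) e)) i<)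

keep : ∀ {A : Set} → Bool → A → List A → List A
keep b x xs = if b then x ∷ xs else xs

filterᵇ-∷ : ∀ {A : Set} (f : A → Bool) x xs → filterᵇ f (x ∷ xs) ≡ keep (f x) x (filterᵇ f xs)
filterᵇ-∷ f x xs with f x
... | true  = refl
... | false = refl

colHeight-ZPath-< : ∀ {k i} → i < k → colHeight (ZPath k) i ≡ suc i
colHeight-ZPath-< {suc k} {zero}  _         = refl
colHeight-ZPath-< {suc k} {suc i} (s≤s i<k) = cong suc (colHeight-ZPath-< i<k)

colHeight-ZPath-self : ∀ k → colHeight (ZPath k) k ≡ k
colHeight-ZPath-self zero    = refl
colHeight-ZPath-self (suc k) = cong suc (colHeight-ZPath-self k)

colHeight-Eᵏ++-< : ∀ {k i} l → i < k → colHeight (replicate k E ++ l) i ≡ 0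
colHeight-Eᵏ++-< {suc k} {zero}  l _         = refl
colHeight-Eᵏ++-< {suc k} {suc i} l (s≤s i<k) = colHeight-Eᵏ++-< l i<k

colHeight-Eᵏ++-self : ∀ k l → colHeight (replicate k E ++ l) k ≡ colHeight l 0
colHeight-Eᵏ++-self zero    l = refl
colHeight-Eᵏ++-self (suc k) l = colHeight-Eᵏ++-self k l

colHeight-Nᵏ : ∀ k i → colHeight (replicate k N) i ≡ k
colHeight-Nᵏ zero    i = refl
colHeight-Nᵏ (suc k) i = cong suc (colHeight-Nᵏ k i)

reflect-NnEn : ∀ k → reflect (NnEn k) ≡ replicate k E ++ replicate k N
reflect-NnEn k = trans (map-++ flip (replicate k N) (replicate k E))
                       (cong₂ _++_ (map-replicate flip k N) (map-replicate flip k E))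

insideCentre-cell : ∀ P Q i j → insideCentre P Q (+ suc (double i)) (+ suc (double j)) ≡ insideCell P Q i j
insideCentre-cell P Q i j = cong₂ (insideCell P Q) (⌊suc-double/2⌋ i) (⌊suc-double/2⌋ j)

nth-++ˡ : ∀ l₁ l₂ {i} → i < length l₁ → nth (l₁ ++ l₂) i ≡ nth l₁ i
nth-++ˡ (b ∷ l₁) l₂ {zero}  _         = refl
nth-++ˡ (b ∷ l₁) l₂ {suc i} (s≤s i<l) = nth-++ˡ l₁ l₂ i<l

nth-++ʳ : ∀ l₁ l₂ j → nth (l₁ ++ l₂) (length l₁ + j) ≡ nth l₂ j
nth-++ʳ []       l₂ j = refl
nth-++ʳ (b ∷ l₁) l₂ j = nth-++ʳ l₁ l₂ j

length-edgesFrom : ∀ x y l → length (edgesFrom x y l) ≡ length l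
length-edgesFrom x y []      = refl
length-edgesFrom x y (N ∷ l) = cong suc (length-edgesFrom x (suc y) l)
length-edgesFrom x y (E ∷ l) = cong suc (length-edgesFrom (suc x) y l)

nth-edges-Eᵏ++-< : ∀ k x y l {s} → s < k →
                   nth (map mkB (edgesFrom x y (replicate k E ++ l))) s ≡ mkB (s + x , y , E)
nth-edges-Eᵏ++-< (suc k) x y l {zero}  _         = refl
nth-edges-Eᵏ++-< (suc k) x y l {suc s} (s≤s s<k) =
  trans (nth-edges-Eᵏ++-< k (suc x) y l s<k) (cong (λ z → mkB (z , y , E)) (+-suc s x))

nth-edges-Eᵏ++-≥ : ∀ k x y l j →
                   nth (map mkB (edgesFrom x y (replicate k E ++ l))) (k + j) ≡ nth (map mkB (edgesFrom (k + x) y l)) j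
nth-edges-Eᵏ++-≥ zero    x y l j = refl
nth-edges-Eᵏ++-≥ (suc k) x y l j =
  trans (nth-edges-Eᵏ++-≥ k (suc x) y l j) (cong (λ z → nth (map mkB (edgesFrom z y l)) j) (+-suc k x))

nth-edges-Nᵏ : ∀ k x y {j} → j < k → nth (map mkB (edgesFrom x y (replicate k N))) j ≡ mkB (x , j + y , N)
nth-edges-Nᵏ (suc k) x y {zero}  _         = refl
nth-edges-Nᵏ (suc k) x y {suc j} (s≤s j<k) =
  trans (nth-edges-Nᵏ k x (suc y) j<k) (cong (λ z → mkB (x , z , N)) (+-suc j y))

nth-edges-ZPath-even : ∀ k c {q} → q < k →
                       nth (map mkB (edgesFrom c c (ZPath k))) (double q) ≡ mkB (q + c , q + c , N)
nth-edges-ZPath-even (suc k) c {zero}  _         = refl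
nth-edges-ZPath-even (suc k) c {suc q} (s≤s q<k) =
  trans (nth-edges-ZPath-even k (suc c) q<k) (cong (λ z → mkB (z , z , N)) (+-suc q c))

nth-edges-ZPath-odd : ∀ k c {q} → q < k →
                      nth (map mkB (edgesFrom c c (ZPath k))) (suc (double q)) ≡ mkB (q + c , suc (q + c) , E)
nth-edges-ZPath-odd (suc k) c {zero}  _         = refl
nth-edges-ZPath-odd (suc k) c {suc q} (s≤s q<k) =
  trans (nth-edges-ZPath-odd k (suc c) q<k) (cong (λ z → mkB (z , suc z , E)) (+-suc q c))

hmid vmid : ℕ → ℕ → Pt
hmid a b = (+ suc (double a) , + double b)
vmid a b = (+ double a , + suc (double b))

↗ ↖ ↘ ↙ : Pt
↗ = (+ 1 , + 1)
↖ = (-[1+ 0 ] , + 1)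
↘ = (+ 1 , -[1+ 0 ])
↙ = (-[1+ 0 ] , -[1+ 0 ])

mkB-E : ∀ x y → mkB (x , y , E) ≡ bstep (hmid x y) true
mkB-E x y = cong₂ (λ a b → bstep (+ suc a , + b) true) (2*≡double x) (2*≡double y)

mkB-N : ∀ x y → mkB (x , y , N) ≡ bstep (vmid x y) false
mkB-N x y = cong₂ (λ a b → bstep (+ a , + suc b) false) (2*≡double x) (2*≡double y)

+[1+_]≡ : ∀ a → + a ℤ.+ + 1 ≡ + suc a
+[1+ a ]≡ = cong +_ (+-comm a 1)

module Staircase (n : ℕ) where

  m : ℕ
  m = suc n

  P Q : Path
  P = ZPath m
  Q = NnEn m

  cell : ℕ → ℕ → Bool
  cell = insideCell P Q

  cell-column : ∀ {i} j → i < m → cell i j ≡ (j <ᵇ suc i)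
  cell-column {i} j i<m = cong₂ (λ a b → (a ≤ᵇ j) ∧ (j <ᵇ b)) lower (colHeight-ZPath-< i<m)
    where
    lower : colHeight (reflect Q) i ≡ 0
    lower = trans (cong (λ l → colHeight l i) (reflect-NnEn m)) (colHeight-Eᵏ++-< (replicate m N) i<m)

  inside : ∀ {i j} → j ≤ i → i < m → cell i j ≡ true
  inside {j = j} j≤i i<m = trans (cell-column j i<m) (Equivalence.to T-≡ (<⇒<ᵇ (s≤s j≤i)))

  outside-above : ∀ {i j} → i < m → i < j → cell i j ≡ false
  outside-above {j = j} i<m i<j = trans (cell-column j i<m) (¬T⇒≡false (<⇒≱ i<j ∘ ≤-pred ∘ <ᵇ⇒< j _))

  outside-right : ∀ j → cell m j ≡ false
  outside-right j = trans (cong₂ (λ a b → (a ≤ᵇ j) ∧ (j <ᵇ b)) left (colHeight-ZPath-self m))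
                          (¬T⇒≡false (λ m≤j∧j<m → let m≤j , j<m = Equivalence.to T-∧ m≤j∧j<m
                                                  in <⇒≱ (<ᵇ⇒< j m j<m) (≤ᵇ⇒≤ m j m≤j)))
    where
    left : colHeight (reflect Q) m ≡ m
    left = trans (cong (λ l → colHeight l m) (reflect-NnEn m))
                 (trans (colHeight-Eᵏ++-self m (replicate m N)) (colHeight-Nᵏ m 0))

  stair : ℕ → ℕ
  stair p = m + m + p

  m≤stair : ∀ p → m ≤ stair p
  m≤stair p = ≤-trans (m≤m+n m m) (m≤m+n (m + m) p)

  data Midpoint : ℕ → Pt → Set where
    bottom : ∀ {s} → s < m → Midpoint s (hmid s 0)
    right  : ∀ {j} → j < m → Midpoint (m + j) (vmid m j)
    riser  : ∀ {k} → k < m → Midpoint (stair (double k)) (vmid k k)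
    tread  : ∀ {k} → k < m → Midpoint (stair (suc (double k))) (hmid k (suc k))

  Midpoint-≡ : ∀ {i i′ p p′} → i ≡ i′ → p ≡ p′ → Midpoint i′ p′ → Midpoint i p
  Midpoint-≡ refl refl w = w

  +suc≡⇒<ˡ : ∀ {a r} → a + suc r ≡ m → a < m
  +suc≡⇒<ˡ {a} e = subst (a <_) e (m<m+n a z<s)

  +suc≡⇒<ʳ : ∀ {a r} → a + suc r ≡ m → r < m
  +suc≡⇒<ʳ {a} {r} e = +suc≡⇒<ˡ (trans (+-suc-comm r a) e)

  bs : List BStep
  bs = boundary P Q

  outerSteps : List BStep
  outerSteps = map mkB (edgesFrom 0 0 (reflect Q))

  outerSteps≡ : outerSteps ≡ map mkB (edgesFrom 0 0 (replicate m E ++ replicate m N))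
  outerSteps≡ = cong (map mkB ∘ edgesFrom 0 0) (reflect-NnEn m)

  length-outerSteps : length outerSteps ≡ m + m
  length-outerSteps = begin
    length outerSteps                      ≡⟨ length-map mkB (edgesFrom 0 0 (reflect Q)) ⟩
    length (edgesFrom 0 0 (reflect Q))     ≡⟨ length-edgesFrom 0 0 (reflect Q) ⟩
    length (reflect Q)                     ≡⟨ length-map flip Q ⟩
    length Q                               ≡⟨ proj₁ (NnEnDyck m) ⟩
    m + m                                  ∎
    where open ≡-Reasoning

  length-bs : length bs ≡ m + m + (m + m)
  length-bs = begin
    length bs
      ≡⟨ length-++ outerSteps ⟩
    length outerSteps + length (map mkB (edgesFrom 0 0 P))
      ≡⟨ cong₂ _+_ length-outerSteps (length-map mkB (edgesFrom 0 0 P)) ⟩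
    m + m + length (edgesFrom 0 0 P)
      ≡⟨ cong (_+_ (m + m)) (trans (length-edgesFrom 0 0 P) (ZLen m)) ⟩
    m + m + (m + m)
      ∎
    where open ≡-Reasoning

  nth-outer : ∀ {i} → i < m + m → nth bs i ≡ nth outerSteps i
  nth-outer {i} i< = nth-++ˡ outerSteps (map mkB (edgesFrom 0 0 P)) (subst (i <_) (sym length-outerSteps) i<)

  nth-stair : ∀ p → nth bs (stair p) ≡ nth (map mkB (edgesFrom 0 0 P)) p
  nth-stair p = trans (cong (λ z → nth bs (z + p)) (sym length-outerSteps)) (nth-++ʳ outerSteps _ p)

  nth-bottom : ∀ {s} → s < m → nth bs s ≡ bstep (hmid s 0) true
  nth-bottom {s} s<m = begin
    nth bs s                                                           ≡⟨ nth-outer (≤-trans s<m (m≤m+n m m)) ⟩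
    nth outerSteps s                                                   ≡⟨ cong (λ l → nth l s) outerSteps≡ ⟩
    nth (map mkB (edgesFrom 0 0 (replicate m E ++ replicate m N))) s   ≡⟨ nth-edges-Eᵏ++-< m 0 0 (replicate m N) s<m ⟩
    mkB (s + 0 , 0 , E)                                                ≡⟨ cong (λ z → mkB (z , 0 , E)) (+-identityʳ s) ⟩
    mkB (s , 0 , E)                                                    ≡⟨ mkB-E s 0 ⟩
    bstep (hmid s 0) true                                              ∎
    where open ≡-Reasoning

  nth-right : ∀ {j} → j < m → nth bs (m + j) ≡ bstep (vmid m j) false
  nth-right {j} j<m = begin
    nth bs (m + j)
      ≡⟨ nth-outer (+-monoʳ-< m j<m) ⟩
    nth outerSteps (m + j)
      ≡⟨ cong (λ l → nth l (m + j)) outerSteps≡ ⟩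
    nth (map mkB (edgesFrom 0 0 (replicate m E ++ replicate m N))) (m + j)
      ≡⟨ nth-edges-Eᵏ++-≥ m 0 0 (replicate m N) j ⟩
    nth (map mkB (edgesFrom (m + 0) 0 (replicate m N))) j
      ≡⟨ nth-edges-Nᵏ m (m + 0) 0 j<m ⟩
    mkB (m + 0 , j + 0 , N)
      ≡⟨ cong₂ (λ x y → mkB (x , y , N)) (+-identityʳ m) (+-identityʳ j) ⟩
    mkB (m , j , N)
      ≡⟨ mkB-N m j ⟩
    bstep (vmid m j) false
      ∎
    where open ≡-Reasoning

  nth-riser : ∀ {k} → k < m → nth bs (stair (double k)) ≡ bstep (vmid k k) false
  nth-riser {k} k<m = begin
    nth bs (stair (double k))  ≡⟨ nth-stair (double k) ⟩
    _                          ≡⟨ nth-edges-ZPath-even m 0 k<m ⟩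
    mkB (k + 0 , k + 0 , N)    ≡⟨ cong (λ z → mkB (z , z , N)) (+-identityʳ k) ⟩
    mkB (k , k , N)            ≡⟨ mkB-N k k ⟩
    bstep (vmid k k) false     ∎
    where open ≡-Reasoning

  nth-tread : ∀ {k} → k < m → nth bs (stair (suc (double k))) ≡ bstep (hmid k (suc k)) true
  nth-tread {k} k<m = begin
    nth bs (stair (suc (double k)))  ≡⟨ nth-stair (suc (double k)) ⟩
    _                                ≡⟨ nth-edges-ZPath-odd m 0 k<m ⟩
    mkB (k + 0 , suc (k + 0) , E)    ≡⟨ cong (λ z → mkB (z , suc z , E)) (+-identityʳ k) ⟩
    mkB (k , suc k , E)              ≡⟨ mkB-E k (suc k) ⟩
    bstep (hmid k (suc k)) true      ∎
    where open ≡-Reasoning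

  mid-nth : ∀ {i p} → Midpoint i p → BStep.mid (nth bs i) ≡ p
  mid-nth (bottom s<m) = cong BStep.mid (nth-bottom s<m)
  mid-nth (right j<m)  = cong BStep.mid (nth-right j<m)
  mid-nth (riser k<m)  = cong BStep.mid (nth-riser k<m)
  mid-nth (tread k<m)  = cong BStep.mid (nth-tread k<m)

  -- Bottom midpoints have ordinate 0, those on the right side abscissa 2m,
  -- and the staircase step number p has its midpoint at abscissa p.
  decode : Pt → ℕ
  decode (+ a , + zero)  = ⌊ a /2⌋
  decode (+ a , + suc b) = if a ≡ᵇ double m then m + ⌊ suc b /2⌋ else stair a
  decode _               = 0

  decode-midpoint : ∀ {i p} → Midpoint i p → decode p ≡ i
  decode-midpoint (bottom {s} _) = ⌊suc-double/2⌋ s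
  decode-midpoint (right {j} _)  =
    trans (cong (if_then m + j′ else stair (double m)) (Equivalence.to T-≡ (≡⇒≡ᵇ (double m) (double m) refl)))
          (cong (_+_ m) (⌊suc-double/2⌋ j))
    where j′ = ⌊ suc (double j) /2⌋
  decode-midpoint (riser {k} k<m) =
    cong (if_then m + ⌊ suc (double k) /2⌋ else stair (double k))
         (¬T⇒≡false (<⇒≢ (<-trans (n<1+n (double k)) (double-mono-< k<m)) ∘ ≡ᵇ⇒≡ (double k) (double m)))
  decode-midpoint (tread {k} k<m) =
    cong (if_then m + ⌊ suc (suc (double k)) /2⌋ else stair (suc (double k)))
         (¬T⇒≡false (double≢suc-double m k ∘ sym ∘ ≡ᵇ⇒≡ (suc (double k)) (double m)))

  midpoint-bound : ∀ {i p} → Midpoint i p → i < length bs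
  midpoint-bound {i} w = subst (i <_) (sym length-bs) (bound w)
    where
    stair-< : ∀ {p} → p < m + m → stair p < m + m + (m + m)
    stair-< = +-monoʳ-< (m + m)
    bound : ∀ {i p} → Midpoint i p → i < m + m + (m + m)
    bound (bottom s<m)  = ≤-trans s<m (≤-trans (m≤m+n m m) (m≤m+n (m + m) (m + m)))
    bound (right j<m)   = ≤-trans (+-monoʳ-< m j<m) (m≤m+n (m + m) (m + m))
    bound (riser {k} k<m) = stair-< (subst (double k <_) (double≡+ m) (<-trans (n<1+n (double k)) (double-mono-< k<m)))
    bound (tread {k} k<m) = stair-< (subst (suc (double k) <_) (double≡+ m) (double-mono-< k<m))

  <length-bs⇒<double : ∀ {p} → m + (m + p) < length bs → p < double m
  <length-bs⇒<double {p} h = subst (p <_) (sym (double≡+ m))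
    (+-cancelˡ-< (m + m) p (m + m) (subst₂ _<_ (sym (+-assoc m m p)) length-bs h))

  midpoint : ∀ {i} → i < length bs → ∃ (Midpoint i)
  midpoint {i} i<bs with i <? m
  ... | yes i<m = _ , bottom i<m
  ... | no i≮m with m≤n⇒∃[o]m+o≡n (≮⇒≥ i≮m)
  ... | j , refl with j <? m
  ... | yes j<m = _ , right j<m
  ... | no j≮m with m≤n⇒∃[o]m+o≡n (≮⇒≥ j≮m)
  ... | p , refl with parity p
  ... | even k = _ , Midpoint-≡ (sym (+-assoc m m (double k))) refl
                       (riser (double-cancel-< (<length-bs⇒<double i<bs)))
  ... | odd k  = _ , Midpoint-≡ (sym (+-assoc m m (suc (double k)))) refl
                       (tread (double-cancel-< (<⇒≤ (<length-bs⇒<double i<bs))))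

  indexOf-midpoint : ∀ {i p} → Midpoint i p → indexOf p bs ≡ i
  indexOf-midpoint {i} w = subst (λ q → indexOf q bs ≡ i) (mid-nth w) (indexOf-nth bs injective (midpoint-bound w))
    where
    decode-nth : ∀ {j} → j < length bs → decode (BStep.mid (nth bs j)) ≡ j
    decode-nth j<bs with midpoint j<bs
    ... | _ , w′ = trans (cong decode (mid-nth w′)) (decode-midpoint w′)
    injective : ∀ {j j′} → j < length bs → j′ < length bs →
                BStep.mid (nth bs j) ≡ BStep.mid (nth bs j′) → j ≡ j′
    injective j<bs j′<bs e = trans (sym (decode-nth j<bs)) (trans (cong decode e) (decode-nth j′<bs))

  -- Beams

  -- A beam entering a cell with a negative coordinate stops by computation
  -- (insideCentre is false there); those steps are proved by refl below.
  turn : Bool → Bool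
  turn h = if h then false else true

  proceed : Bool → ℕ → Pt → Pt → Bool → Pt
  proceed c k q d h = if c then shoot k P Q q d h else q

  shoot-step : ∀ k x y dx dy h {x′ y′ i j c} → x ℤ.+ dx ≡ x′ → y ℤ.+ dy ≡ y′ →
               cellAhead (x′ , y′) (dx , dy) (turn h) ≡ (+ suc (double i) , + suc (double j)) →
               cell i j ≡ c →
               shoot (suc k) P Q (x , y) (dx , dy) h ≡ proceed c k (x′ , y′) (dx , dy) (turn h)
  shoot-step k x y dx dy h {i = i} {j} refl refl ahead refl =
    trans (cong (λ z → proceed (insideCentre P Q (proj₁ z) (proj₂ z)) k next (dx , dy) (turn h)) ahead)
          (cong (λ c → proceed c k next (dx , dy) (turn h)) (insideCentre-cell P Q i j))
    where
    next : Pt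
    next = (x ℤ.+ dx , y ℤ.+ dy)

  step-hmid-↗ : ∀ k a b {c} → cell (suc a) b ≡ c →
                shoot (suc k) P Q (hmid a b) ↗ true ≡ proceed c k (vmid (suc a) b) ↗ false
  step-hmid-↗ k a b = shoot-step k (+ suc (double a)) (+ double b) _ _ true
    +[1+ suc (double a) ]≡ +[1+ double b ]≡ (cong (_, + suc (double b)) +[1+ double (suc a) ]≡)

  step-vmid-↗ : ∀ k a b {c} → cell a (suc b) ≡ c →
                shoot (suc k) P Q (vmid a b) ↗ false ≡ proceed c k (hmid a (suc b)) ↗ true
  step-vmid-↗ k a b = shoot-step k (+ double a) (+ suc (double b)) _ _ false
    +[1+ double a ]≡ +[1+ suc (double b) ]≡ (cong (+ suc (double a) ,_) +[1+ double (suc b) ]≡)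

  step-hmid-↖ : ∀ k a b {c} → cell a b ≡ c →
                shoot (suc k) P Q (hmid (suc a) b) ↖ true ≡ proceed c k (vmid (suc a) b) ↖ false
  step-hmid-↖ k a b = shoot-step k (+ suc (double (suc a))) (+ double b) _ _ true
    refl +[1+ double b ]≡ refl

  step-vmid-↖ : ∀ k a b {c} → cell a (suc b) ≡ c →
                shoot (suc k) P Q (vmid (suc a) b) ↖ false ≡ proceed c k (hmid a (suc b)) ↖ true
  step-vmid-↖ k a b = shoot-step k (+ double (suc a)) (+ suc (double b)) _ _ false
    refl +[1+ suc (double b) ]≡ (cong (+ suc (double a) ,_) +[1+ double (suc b) ]≡)

  step-hmid-↘ : ∀ k a b {c} → cell (suc a) b ≡ c →
                shoot (suc k) P Q (hmid a (suc b)) ↘ true ≡ proceed c k (vmid (suc a) b) ↘ false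
  step-hmid-↘ k a b = shoot-step k (+ suc (double a)) (+ double (suc b)) _ _ true
    +[1+ suc (double a) ]≡ refl (cong (_, + suc (double b)) +[1+ double (suc a) ]≡)

  step-vmid-↘ : ∀ k a b {c} → cell a b ≡ c →
                shoot (suc k) P Q (vmid a (suc b)) ↘ false ≡ proceed c k (hmid a (suc b)) ↘ true
  step-vmid-↘ k a b = shoot-step k (+ double a) (+ suc (double (suc b))) _ _ false
    +[1+ double a ]≡ refl refl

  step-hmid-↙ : ∀ k a b {c} → cell a b ≡ c →
                shoot (suc k) P Q (hmid (suc a) (suc b)) ↙ true ≡ proceed c k (vmid (suc a) b) ↙ false
  step-hmid-↙ k a b = shoot-step k (+ suc (double (suc a))) (+ double (suc b)) _ _ true
    refl refl refl

  step-vmid-↙ : ∀ k a b {c} → cell a b ≡ c →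
                shoot (suc k) P Q (vmid (suc a) (suc b)) ↙ false ≡ proceed c k (hmid a (suc b)) ↙ true
  step-vmid-↙ k a b = shoot-step k (+ double (suc a)) (+ suc (double (suc b))) _ _ false
    refl refl refl

  ↗-to-right : ∀ r {a b} e → a + suc r ≡ m → b ≤ a →
               shoot (suc (double r + e)) P Q (hmid a b) ↗ true ≡ vmid m (b + r)
  ↗-to-right zero {a} {b} e a+1≡m b≤a = begin
    shoot (suc e) P Q (hmid a b) ↗ true  ≡⟨ step-hmid-↗ e a b (subst (λ c → cell c b ≡ false) (sym 1+a≡m) (outside-right b)) ⟩
    vmid (suc a) b                       ≡⟨ cong₂ vmid 1+a≡m (sym (+-identityʳ b)) ⟩
    vmid m (b + 0)                       ∎
    where
    open ≡-Reasoning
    1+a≡m : suc a ≡ m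
    1+a≡m = trans (+-comm 1 a) a+1≡m
  ↗-to-right (suc r) {a} {b} e a+r≡m b≤a = begin
    shoot (suc (suc (suc k))) P Q (hmid a b) ↗ true         ≡⟨ step-hmid-↗ (suc (suc k)) a b (inside (m≤n⇒m≤1+n b≤a) 1+a<m) ⟩
    shoot (suc (suc k)) P Q (vmid (suc a) b) ↗ false        ≡⟨ step-vmid-↗ (suc k) (suc a) b (inside (s≤s b≤a) 1+a<m) ⟩
    shoot (suc k) P Q (hmid (suc a) (suc b)) ↗ true         ≡⟨ ↗-to-right r e 1+a+r≡m (s≤s b≤a) ⟩
    vmid m (suc b + r)                                      ≡⟨ cong (vmid m) (+-suc b r) ⟨
    vmid m (b + suc r)                                      ∎
    where
    open ≡-Reasoning
    k : ℕ
    k = double r + e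
    1+a+r≡m : suc a + suc r ≡ m
    1+a+r≡m = trans (sym (+-suc a (suc r))) a+r≡m
    1+a<m : suc a < m
    1+a<m = +suc≡⇒<ˡ 1+a+r≡m

  ↙-to-bottom : ∀ b {c} e → b + c < m → shoot (suc (double b + e)) P Q (vmid (suc (b + c)) b) ↙ false ≡ hmid c 0
  ↙-to-bottom zero    e _ = refl
  ↙-to-bottom (suc b) {c} e 1+b+c<m = begin
    shoot (suc (suc (suc k))) P Q (vmid (suc (suc (b + c))) (suc b)) ↙ false
      ≡⟨ step-vmid-↙ (suc (suc k)) (suc (b + c)) b (inside (m≤n⇒m≤1+n (m≤m+n b c)) 1+b+c<m) ⟩
    shoot (suc (suc k)) P Q (hmid (suc (b + c)) (suc b)) ↙ true
      ≡⟨ step-hmid-↙ (suc k) (b + c) b (inside (m≤m+n b c) (<⇒≤ 1+b+c<m)) ⟩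
    shoot (suc k) P Q (vmid (suc (b + c)) b) ↙ false
      ≡⟨ ↙-to-bottom b e (<⇒≤ 1+b+c<m) ⟩
    hmid c 0
      ∎
    where
    open ≡-Reasoning
    k : ℕ
    k = double b + e

  ↗-riser-to-tread : ∀ {k} e → k < m → shoot (suc e) P Q (vmid k k) ↗ false ≡ hmid k (suc k)
  ↗-riser-to-tread {k} e k<m = step-vmid-↗ e k k (outside-above k<m (n<1+n k))

  ↙-tread-to-riser : ∀ {k} e → k < m → shoot (suc e) P Q (hmid k (suc k)) ↙ true ≡ vmid k k
  ↙-tread-to-riser {zero}  e _     = refl
  ↙-tread-to-riser {suc k} e 1+k<m = step-hmid-↙ e k (suc k) (outside-above (<⇒≤ 1+k<m) (n<1+n k))

  -- Beams in directions ↘ and ↖ keep the sum of the coordinates fixed, which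
  -- is why the beams below join outer step a + b and staircase step a + b.
  mutual
    ↘-from-vmid : ∀ b {a} e → b ≤ suc a → a < m →
                  Midpoint (a + b) (shoot (suc (double b + e)) P Q (vmid a b) ↘ false)
    ↘-from-vmid zero    {a} e _ a<m = Midpoint-≡ (+-identityʳ a) (cong (_, + 0) +[1+ double a ]≡) (bottom a<m)
    ↘-from-vmid (suc b) {a} e b<1+a a<m =
      Midpoint-≡ refl (step-vmid-↘ (suc (suc (double b + e))) a b (inside (≤-pred b<1+a) a<m))
                 (↘-from-hmid b e (≤-pred b<1+a) a<m)

    ↘-from-hmid : ∀ b {a} e → b ≤ a → a < m →
                  Midpoint (a + suc b) (shoot (suc (suc (double b + e))) P Q (hmid a (suc b)) ↘ true)
    ↘-from-hmid b {a} e b≤a a<m with m≤n⇒m<n∨m≡n a<m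
    ... | inj₁ 1+a<m = Midpoint-≡ (+-suc a b) (step-hmid-↘ (suc (double b + e)) a b (inside (m≤n⇒m≤1+n b≤a) 1+a<m))
                                   (↘-from-vmid b e (m≤n⇒m≤1+n (m≤n⇒m≤1+n b≤a)) 1+a<m)
    ... | inj₂ refl  = Midpoint-≡ (+-suc a b) (step-hmid-↘ (suc (double b + e)) a b (outside-right b))
                                   (right (s≤s b≤a))

  mutual
    ↖-from-hmid : ∀ a {b} e → b ≤ a → a < m →
                  Midpoint (stair (a + b)) (shoot (suc (double a + e)) P Q (hmid a b) ↖ true)
    ↖-from-hmid zero    {zero} e _ 0<m = riser 0<m
    ↖-from-hmid (suc a) {b} e b≤1+a 1+a<m with m≤n⇒m<n∨m≡n b≤1+a
    ... | inj₁ b<1+a = Midpoint-≡ refl (step-hmid-↖ (suc (suc (double a + e))) a b (inside (≤-pred b<1+a) (<⇒≤ 1+a<m)))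
                                   (↖-from-vmid a e (≤-pred b<1+a) (<⇒≤ 1+a<m))
    ... | inj₂ refl  = Midpoint-≡ (cong stair (sym (double≡+ (suc a))))
                                   (step-hmid-↖ (suc (suc (double a + e))) a b (outside-above (<⇒≤ 1+a<m) (n<1+n a)))
                                   (riser 1+a<m)

    ↖-from-vmid : ∀ a {b} e → b ≤ a → a < m →
                  Midpoint (stair (suc a + b)) (shoot (suc (suc (double a + e))) P Q (vmid (suc a) b) ↖ false)
    ↖-from-vmid a {b} e b≤a a<m with m≤n⇒m<n∨m≡n b≤a
    ... | inj₁ b<a  = Midpoint-≡ (cong stair (sym (+-suc a b))) (step-vmid-↖ (suc (double a + e)) a b (inside b<a a<m))
                                 (↖-from-hmid a e b<a a<m)
    ... | inj₂ refl = Midpoint-≡ (cong (stair ∘ suc) (sym (double≡+ a)))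
                                 (step-vmid-↖ (suc (double a + e)) a b (outside-above a<m (n<1+n a)))
                                 (tread a<m)

  towardInside : Pt → Bool → Pt → Bool
  towardInside p h d = insideCentre P Q (proj₁ (cellAhead p d h)) (proj₂ (cellAhead p d h))

  inwardDirs-by : ∀ {p h b₁ b₂ b₃ b₄} →
                  towardInside p h ↗ ≡ b₁ → towardInside p h ↖ ≡ b₂ →
                  towardInside p h ↘ ≡ b₃ → towardInside p h ↙ ≡ b₄ →
                  inwardDirs P Q (bstep p h) ≡ keep b₁ ↗ (keep b₂ ↖ (keep b₃ ↘ (keep b₄ ↙ [])))
  inwardDirs-by {p} {h} refl refl refl refl =
    trans (filterᵇ-∷ F ↗ _) (cong (keep (F ↗) ↗)
      (trans (filterᵇ-∷ F ↖ _) (cong (keep (F ↖) ↖)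
        (trans (filterᵇ-∷ F ↘ _) (cong (keep (F ↘) ↘) (filterᵇ-∷ F ↙ []))))))
    where
    F : Pt → Bool
    F = towardInside p h

  centre≡cell : ∀ i j {x y} → x ≡ + suc (double i) → y ≡ + suc (double j) → insideCentre P Q x y ≡ cell i j
  centre≡cell i j refl refl = insideCentre-cell P Q i j

  inward-bottom : ∀ {s} → s < m → inwardDirs P Q (bstep (hmid s 0) true) ≡ ↗ ∷ ↖ ∷ []
  inward-bottom {s} s<m = inwardDirs-by {hmid s 0} {true} in-cell in-cell refl refl
    where
    in-cell : insideCentre P Q (+ suc (double s)) (+ 1) ≡ true
    in-cell = trans (centre≡cell s 0 refl refl) (inside z≤n s<m)

  inward-right : ∀ {j} → j < m → inwardDirs P Q (bstep (vmid m j) false) ≡ ↖ ∷ ↙ ∷ []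
  inward-right {j} j<m = inwardDirs-by {vmid m j} {false} out-cell in-cell out-cell in-cell
    where
    in-cell : insideCentre P Q (+ suc (double n)) (+ suc (double j)) ≡ true
    in-cell = trans (centre≡cell n j refl refl) (inside (≤-pred j<m) (n<1+n n))
    out-cell : insideCentre P Q (+ double m ℤ.+ + 1) (+ suc (double j)) ≡ false
    out-cell = trans (centre≡cell m j +[1+ double m ]≡ refl) (outside-right j)

  inward-riser : ∀ {k} → k < m → inwardDirs P Q (bstep (vmid k k) false) ≡ ↗ ∷ ↘ ∷ []
  inward-riser {k} k<m = inwardDirs-by {vmid k k} {false} in-cell (out-cell k k<m) in-cell (out-cell k k<m)
    where
    in-cell : insideCentre P Q (+ double k ℤ.+ + 1) (+ suc (double k)) ≡ true
    in-cell = trans (centre≡cell k k +[1+ double k ]≡ refl) (inside ≤-refl k<m)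
    out-cell : ∀ k → k < m → insideCentre P Q (+ double k ℤ.+ -[1+ 0 ]) (+ suc (double k)) ≡ false
    out-cell zero    _     = refl
    out-cell (suc k) 1+k<m = trans (centre≡cell k (suc k) refl refl) (outside-above (<⇒≤ 1+k<m) (n<1+n k))

  inward-tread : ∀ {k} → k < m → inwardDirs P Q (bstep (hmid k (suc k)) true) ≡ ↘ ∷ ↙ ∷ []
  inward-tread {k} k<m = inwardDirs-by {hmid k (suc k)} {true} out-cell out-cell in-cell in-cell
    where
    in-cell : insideCentre P Q (+ suc (double k)) (+ suc (double k)) ≡ true
    in-cell = trans (centre≡cell k k refl refl) (inside ≤-refl k<m)
    out-cell : insideCentre P Q (+ suc (double k)) (+ double (suc k) ℤ.+ + 1) ≡ false
    out-cell = trans (centre≡cell k (suc k) refl +[1+ double (suc k) ]≡) (outside-above k<m (n<1+n k))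

  fuel : ℕ
  fuel = length P + length Q + 1

  hit : Pt → Pt → Bool → ℕ
  hit p d h = indexOf (shoot fuel P Q p d h) bs

  beamTargets-by : ∀ i {p h d₁ d₂} → nth bs i ≡ bstep p h → inwardDirs P Q (bstep p h) ≡ d₁ ∷ d₂ ∷ [] →
                   beamTargets P Q i ≡ hit p d₁ h ∷ hit p d₂ h ∷ []
  beamTargets-by i {p} {h} nth≡ inward≡ = trans (cong hits nth≡) (cong (map (λ d → hit p d h)) inward≡)
    where
    hits : BStep → List ℕ
    hits b = map (λ d → hit (BStep.mid b) d (BStep.horiz b)) (inwardDirs P Q b)

  hit-by : ∀ p d h {i} x → x ≤ m + m + (m + m) →
           (∀ e → Midpoint i (shoot (suc (x + e)) P Q p d h)) → hit p d h ≡ i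
  hit-by p d h {i} x x≤ walk with m≤n⇒∃[o]m+o≡n x≤
  ... | e , x+e≡ = indexOf-midpoint (subst (λ k → Midpoint i (shoot k P Q p d h)) fuel≡ (walk e))
    where
    fuel≡ : suc (x + e) ≡ fuel
    fuel≡ = begin
      suc (x + e)                  ≡⟨ cong suc x+e≡ ⟩
      suc (m + m + (m + m))        ≡⟨ +-comm 1 _ ⟩
      m + m + (m + m) + 1          ≡⟨ cong₂ (λ a b → a + b + 1) (ZLen m) (proj₁ (NnEnDyck m)) ⟨
      fuel                         ∎
      where open ≡-Reasoning

  odd-≤ : ∀ {k} → k < m → suc (double k) ≤ m + m + (m + m)
  odd-≤ {k} k<m =
    ≤-trans (<⇒≤ (subst (suc (double k) <_) (double≡+ m) (double-mono-< k<m))) (m≤m+n (m + m) (m + m))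

  even-≤ : ∀ {k} → k < m → double k ≤ m + m + (m + m)
  even-≤ k<m = <⇒≤ (odd-≤ k<m)

  beamTargets-bottom : ∀ {s j} → s + suc j ≡ m → beamTargets P Q s ≡ (m + j) ∷ stair s ∷ []
  beamTargets-bottom {s} {j} s+j≡m =
    trans (beamTargets-by s (nth-bottom s<m) (inward-bottom s<m))
          (cong₂ (λ a b → a ∷ b ∷ []) to-right to-stair)
    where
    s<m : s < m
    s<m = +suc≡⇒<ˡ s+j≡m
    j<m : j < m
    j<m = +suc≡⇒<ʳ s+j≡m
    to-right : hit (hmid s 0) ↗ true ≡ m + j
    to-right = hit-by (hmid s 0) ↗ true (double j) (even-≤ j<m)
      (λ e → Midpoint-≡ refl (↗-to-right j e s+j≡m z≤n) (right j<m))
    to-stair : hit (hmid s 0) ↖ true ≡ stair s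
    to-stair = hit-by (hmid s 0) ↖ true (double s) (even-≤ s<m)
      (λ e → Midpoint-≡ (cong stair (sym (+-identityʳ s))) refl (↖-from-hmid s e z≤n s<m))

  beamTargets-right : ∀ {s j} → s + suc j ≡ m → beamTargets P Q (m + j) ≡ stair (m + j) ∷ s ∷ []
  beamTargets-right {s} {j} s+j≡m =
    trans (beamTargets-by (m + j) (nth-right j<m) (inward-right j<m))
          (cong₂ (λ a b → a ∷ b ∷ []) to-stair to-bottom)
    where
    s<m : s < m
    s<m = +suc≡⇒<ˡ s+j≡m
    j<m : j < m
    j<m = +suc≡⇒<ʳ s+j≡m
    m≡1+j+s : m ≡ suc (j + s)
    m≡1+j+s = trans (sym s+j≡m) (trans (+-suc s j) (cong suc (+-comm s j)))
    to-stair : hit (vmid m j) ↖ false ≡ stair (m + j)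
    to-stair = hit-by (vmid m j) ↖ false (suc (double n)) (odd-≤ (n<1+n n))
      (λ e → ↖-from-vmid n e (≤-pred j<m) (n<1+n n))
    to-bottom : hit (vmid m j) ↙ false ≡ s
    to-bottom = hit-by (vmid m j) ↙ false (double j) (even-≤ j<m)
      (λ e → Midpoint-≡ refl
        (trans (cong (λ a → shoot (suc (double j + e)) P Q (vmid a j) ↙ false) m≡1+j+s)
               (↙-to-bottom j e (subst (j + s <_) (sym m≡1+j+s) (n<1+n _))))
        (bottom s<m))

  beamTargets-riser : ∀ {k} → k < m →
                      beamTargets P Q (stair (double k)) ≡ stair (suc (double k)) ∷ double k ∷ []
  beamTargets-riser {k} k<m =
    trans (beamTargets-by (stair (double k)) (nth-riser k<m) (inward-riser k<m))
          (cong₂ (λ a b → a ∷ b ∷ []) to-tread to-outer)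
    where
    to-tread : hit (vmid k k) ↗ false ≡ stair (suc (double k))
    to-tread = hit-by (vmid k k) ↗ false 0 z≤n
      (λ e → Midpoint-≡ refl (↗-riser-to-tread e k<m) (tread k<m))
    to-outer : hit (vmid k k) ↘ false ≡ double k
    to-outer = hit-by (vmid k k) ↘ false (double k) (even-≤ k<m)
      (λ e → Midpoint-≡ (double≡+ k) refl (↘-from-vmid k e (n≤1+n k) k<m))

  beamTargets-tread : ∀ {k} → k < m →
                      beamTargets P Q (stair (suc (double k))) ≡ suc (double k) ∷ stair (double k) ∷ []
  beamTargets-tread {k} k<m =
    trans (beamTargets-by (stair (suc (double k))) (nth-tread k<m) (inward-tread k<m))
          (cong₂ (λ a b → a ∷ b ∷ []) to-outer to-riser)
    where
    to-outer : hit (hmid k (suc k)) ↘ true ≡ suc (double k)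
    to-outer = hit-by (hmid k (suc k)) ↘ true (suc (double k)) (odd-≤ k<m)
      (λ e → Midpoint-≡ (trans (cong suc (double≡+ k)) (sym (+-suc k k))) refl (↘-from-hmid k e ≤-refl k<m))
    to-riser : hit (hmid k (suc k)) ↙ true ≡ stair (double k)
    to-riser = hit-by (hmid k (suc k)) ↙ true 0 z≤n
      (λ e → Midpoint-≡ refl (↙-tread-to-riser e k<m) (riser k<m))

  -- The light graph

  nb : ℕ → List ℕ
  nb = beamTargets P Q

  ∈-pair : ∀ {y a b : ℕ} → y ∈ a ∷ b ∷ [] → y ≡ a ⊎ y ≡ b
  ∈-pair (here y≡a)         = inj₁ y≡a
  ∈-pair (there (here y≡b)) = inj₂ y≡b

  nb-outer : ∀ {p y} → p < double m → y ∈ nb p →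
             y ≡ stair p ⊎ ∃[ p′ ] (p + suc p′ ≡ double m × y ≡ p′)
  nb-outer {p} {y} p<2m y∈ with p <? m
  ... | yes p<m with <⇒∃+suc p<m
  ... | j , p+j≡m with ∈-pair (subst (y ∈_) (beamTargets-bottom p+j≡m) y∈)
  ... | inj₁ refl = inj₂ (m + j , facing , refl)
    where
    facing : p + suc (m + j) ≡ double m
    facing = begin
      p + suc (m + j)  ≡⟨ cong (λ z → p + suc z) (+-comm m j) ⟩
      p + (suc j + m)  ≡⟨ +-assoc p (suc j) m ⟨
      p + suc j + m    ≡⟨ cong (_+ m) p+j≡m ⟩
      m + m            ≡⟨ double≡+ m ⟨
      double m         ∎
      where open ≡-Reasoning
  ... | inj₂ refl = inj₁ refl
  nb-outer {p} {y} p<2m y∈ | no p≮m with m≤n⇒∃[o]m+o≡n (≮⇒≥ p≮m)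
  ... | t , refl with <⇒∃+suc (+-cancelˡ-< m t m (subst (m + t <_) (double≡+ m) p<2m))
  ... | s , t+s≡m with ∈-pair (subst (y ∈_) (beamTargets-right (trans (+-suc-comm s t) t+s≡m)) y∈)
  ... | inj₁ refl = inj₁ refl
  ... | inj₂ refl = inj₂ (s , facing , refl)
    where
    facing : m + t + suc s ≡ double m
    facing = trans (+-assoc m t (suc s)) (trans (cong (_+_ m) t+s≡m) (sym (double≡+ m)))

  nb-stair : ∀ {p y} → p < double m → y ∈ nb (stair p) →
             y ≡ p ⊎ ∃[ p′ ] (⌊ p′ /2⌋ ≡ ⌊ p /2⌋ × y ≡ stair p′)
  nb-stair {p} {y} p<2m y∈ with parity p
  ... | even k with ∈-pair (subst (y ∈_) (beamTargets-riser (double-cancel-< p<2m)) y∈)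
  ... | inj₁ refl = inj₂ (suc (double k) , trans (⌊suc-double/2⌋ k) (sym (⌊double/2⌋ k)) , refl)
  ... | inj₂ refl = inj₁ refl
  nb-stair {p} {y} p<2m y∈ | odd k with ∈-pair (subst (y ∈_) (beamTargets-tread (double-cancel-< (<⇒≤ p<2m))) y∈)
  ... | inj₁ refl = inj₁ refl
  ... | inj₂ refl = inj₂ (double k , trans (⌊double/2⌋ k) (sym (⌊suc-double/2⌋ k)) , refl)

  open Reach nb

  module Component {q q′} (q+q′≡m : q + suc q′ ≡ m) where

    InPair : ℕ → Set
    InPair p = ⌊ p /2⌋ ≡ q ⊎ ⌊ p /2⌋ ≡ q′

    Member : ℕ → Set
    Member x = ∃[ p ] (InPair p × (x ≡ p ⊎ x ≡ stair p))

    InPair-< : ∀ {p} → InPair p → p < double m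
    InPair-< {p} (inj₁ p/2≡q)  = <-double p (subst (_< m) (sym p/2≡q) (+suc≡⇒<ˡ q+q′≡m))
    InPair-< {p} (inj₂ p/2≡q′) = <-double p (subst (_< m) (sym p/2≡q′) (+suc≡⇒<ʳ q+q′≡m))

    InPair-facing : ∀ {p p′} → InPair p → p + suc p′ ≡ double m → InPair p′
    InPair-facing {p} {p′} (inj₁ refl) facing =
      inj₂ (suc-injective (+-cancelˡ-≡ ⌊ p /2⌋ _ _ (trans (⌊/2⌋-mirror p p′ facing) (sym q+q′≡m))))
    InPair-facing {p} {p′} (inj₂ refl) facing =
      inj₁ (suc-injective (+-cancelˡ-≡ ⌊ p /2⌋ _ _ (trans (⌊/2⌋-mirror p p′ facing) (trans (sym q+q′≡m) (+-suc-comm q q′)))))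

    closed : ∀ {x y} → Member x → y ∈ nb x → Member y
    closed (p , in-pair , inj₁ refl) y∈ with nb-outer (InPair-< in-pair) y∈
    ... | inj₁ refl                   = p , in-pair , inj₂ refl
    ... | inj₂ (p′ , facing , refl)   = p′ , InPair-facing in-pair facing , inj₁ refl
    closed (p , in-pair , inj₂ refl) y∈ with nb-stair (InPair-< in-pair) y∈
    ... | inj₁ refl                   = p , in-pair , inj₁ refl
    ... | inj₂ (p′ , same-pair , refl) = p′ , Data.Sum.map (trans same-pair) (trans same-pair) in-pair , inj₂ refl

    double-least : q ≤ q′ → ∀ M → leastInComponent nb M (double q) ≡ true
    double-least q≤q′ M = least-if-closed Member closed {M} (double q , inj₁ (⌊double/2⌋ q) , inj₁ refl) bound
      where
      below : ∀ {p} → InPair p → double q ≤ p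
      below {p} (inj₁ p/2≡q)  = double-≤ p (≤-reflexive (sym p/2≡q))
      below {p} (inj₂ p/2≡q′) = double-≤ p (subst (q ≤_) (sym p/2≡q′) q≤q′)
      bound : ∀ {x} → Member x → double q ≤ x
      bound (p , in-pair , inj₁ refl) = below in-pair
      bound (p , in-pair , inj₂ refl) = ≤-trans (below in-pair) (m≤n+m p (m + m))

  evenBottom : ℕ → Bool
  evenBottom i = (i <ᵇ m) ∧ isEven i

  not-evenBottom : ∀ {i} → m ≤ i → evenBottom i ≡ false
  not-evenBottom {i} m≤i = cong (_∧ isEven i) (¬T⇒≡false (λ i<ᵇm → <⇒≱ (<ᵇ⇒< i m i<ᵇm) m≤i))

  second∈ : ∀ x {a b} → nb x ≡ a ∷ b ∷ [] → b ∈ nb x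
  second∈ x {b = b} nb≡ = subst (b ∈_) (sym nb≡) (there (here refl))

  first∈ : ∀ x {a b} → nb x ≡ a ∷ b ∷ [] → a ∈ nb x
  first∈ x {a} nb≡ = subst (a ∈_) (sym nb≡) (here refl)

  3≤length-bs : 3 ≤ length bs
  3≤length-bs = subst (3 ≤_) (sym length-bs) (≤-trans (n≤1+n 3) (+-mono-≤ 2≤m+m 2≤m+m))
    where
    2≤m+m : 2 ≤ m + m
    2≤m+m = +-mono-≤ (s≤s z≤n) (s≤s z≤n)

  reach-one : ∀ {x y} → y ∈ nb x → y ∈ reach nb (length bs) x
  reach-one {x} y∈ = reach-mono (≤-trans (s≤s z≤n) 3≤length-bs) (reach-step 0 (reach-refl 0 x) y∈)

  least-even-bottom : ∀ {q} → double q < m → leastInComponent nb (length bs) (double q) ≡ true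
  least-even-bottom {q} 2q<m = Component.double-least q+q′≡m q≤q′ (length bs)
    where
    q′ : ℕ
    q′ = proj₁ (<⇒∃+suc (≤-<-trans (n≤double q) 2q<m))
    q+q′≡m : q + suc q′ ≡ m
    q+q′≡m = proj₂ (<⇒∃+suc (≤-<-trans (n≤double q) 2q<m))
    q≤q′ : q ≤ q′
    q≤q′ = ≤-pred (+-cancelˡ-< q q (suc q′) (subst₂ _<_ (double≡+ q) (sym q+q′≡m) 2q<m))

  not-least-odd-bottom : ∀ {q} → suc (double q) < m → leastInComponent nb (length bs) (suc (double q)) ≡ false
  not-least-odd-bottom {q} 2q+1<m = not-least {length bs} (reach-mono 3≤length-bs via-staircase) (n<1+n (double q))
    where
    q<m : q < m
    q<m = ≤-<-trans (n≤double q) (<⇒≤ 2q+1<m)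
    via-staircase : double q ∈ reach nb 3 (suc (double q))
    via-staircase =
      reach-step 2 (reach-step 1 (reach-step 0 (reach-refl 0 _)
        (second∈ (suc (double q)) (beamTargets-bottom (proj₂ (<⇒∃+suc 2q+1<m)))))
        (second∈ (stair (suc (double q))) (beamTargets-tread q<m)))
        (second∈ (stair (double q)) (beamTargets-riser q<m))

  not-least-right : ∀ {j} → j < m → leastInComponent nb (length bs) (m + j) ≡ false
  not-least-right {j} j<m =
    not-least {length bs} (reach-one (second∈ (m + j) (beamTargets-right s+j≡m)))
                          (≤-trans (+suc≡⇒<ˡ s+j≡m) (m≤m+n m j))
    where
    s+j≡m : proj₁ (<⇒∃+suc j<m) + suc j ≡ m
    s+j≡m = trans (+-suc-comm _ j) (proj₂ (<⇒∃+suc j<m))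

  not-least-stair : ∀ {p} → p < double m → leastInComponent nb (length bs) (stair p) ≡ false
  not-least-stair {p} p<2m =
    not-least {length bs} (reach-one (p∈nb p<2m)) (m<n+m p (≤-trans (s≤s z≤n) (m≤m+n m m)))
    where
    p∈nb : ∀ {p} → p < double m → p ∈ nb (stair p)
    p∈nb {p} p<2m with parity p
    ... | even k = second∈ (stair (double k)) (beamTargets-riser (double-cancel-< p<2m))
    ... | odd k  = first∈ (stair (suc (double k))) (beamTargets-tread (double-cancel-< (<⇒≤ p<2m)))

  leastInComponent≡evenBottom : ∀ {i} → i < length bs → leastInComponent nb (length bs) i ≡ evenBottom i
  leastInComponent≡evenBottom i<bs with midpoint i<bs
  ... | _ , bottom {s} s<m with parity s
  ... | even q = trans (least-even-bottom s<m) (sym (cong₂ _∧_ (Equivalence.to T-≡ (<⇒<ᵇ s<m)) (isEven-double q)))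
  ... | odd q  = trans (not-least-odd-bottom s<m)
                       (sym (trans (cong (λ b → (suc (double q) <ᵇ m) ∧ not b) (isEven-double q)) (∧-zeroʳ _)))
  leastInComponent≡evenBottom i<bs | _ , right {j} j<m = trans (not-least-right j<m) (sym (not-evenBottom (m≤m+n m j)))
  leastInComponent≡evenBottom i<bs | _ , riser {k} k<m =
    trans (not-least-stair (<-trans (n<1+n _) (double-mono-< k<m))) (sym (not-evenBottom (m≤stair (double k))))
  leastInComponent≡evenBottom i<bs | _ , tread {k} k<m =
    trans (not-least-stair (double-mono-< k<m)) (sym (not-evenBottom (m≤stair (suc (double k)))))

  trajPaths≡⌈m/2⌉ : trajPaths P Q ≡ ⌈ m /2⌉
  trajPaths≡⌈m/2⌉ = begin
    count (leastInComponent nb (length bs)) (length bs)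
      ≡⟨ count-cong {g = evenBottom} (length bs) leastInComponent≡evenBottom ⟩
    count evenBottom (length bs)
      ≡⟨ cong (count evenBottom) (trans length-bs (+-assoc m m (m + m))) ⟩
    count evenBottom (m + (m + (m + m)))
      ≡⟨ count-beyond evenBottom m (m + (m + m)) not-evenBottom ⟩
    count evenBottom m
      ≡⟨ count-cong {g = isEven} m (λ {i} i<m → cong (_∧ isEven i) (Equivalence.to T-≡ (<⇒<ᵇ i<m))) ⟩
    count isEven m
      ≡⟨ count-isEven m ⟩
    ⌈ m /2⌉
      ∎
    where open ≡-Reasoning

traj-Z : ∀ n → traj (Z (suc n)) ≡ ⌈ suc n /2⌉
traj-Z n = Staircase.trajPaths≡⌈m/2⌉ n

⌈1+n/2⌉-parity : ∀ n → ((n % 4 ≡ 0 ⊎ n % 4 ≡ 1) → ⌈ suc n /2⌉ % 2 ≡ 1) ×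
                        ((n % 4 ≡ 2 ⊎ n % 4 ≡ 3) → ⌈ suc n /2⌉ % 2 ≡ 0)
⌈1+n/2⌉-parity 0 = (λ _ → refl) , λ { (inj₁ ()) ; (inj₂ ()) }
⌈1+n/2⌉-parity 1 = (λ _ → refl) , λ { (inj₁ ()) ; (inj₂ ()) }
⌈1+n/2⌉-parity 2 = (λ { (inj₁ ()) ; (inj₂ ()) }) , λ _ → refl
⌈1+n/2⌉-parity 3 = (λ { (inj₁ ()) ; (inj₂ ()) }) , λ _ → refl
-- Both n % 4 and ⌈ suc n /2⌉ % 2 are unchanged by n ↦ n + 4 by computation.
⌈1+n/2⌉-parity (suc (suc (suc (suc n)))) = ⌈1+n/2⌉-parity n

-- traj-Z holds for every n.
lemma4p1 : (n : ℕ) → 1 ≤ n →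
    ((n % 4 ≡ 0 ⊎ n % 4 ≡ 1) → traj (Z (suc n)) % 2 ≡ 1) ×
    ((n % 4 ≡ 2 ⊎ n % 4 ≡ 3) → traj (Z (suc n)) % 2 ≡ 0)
lemma4p1 n _ rewrite traj-Z n = ⌈1+n/2⌉-parity n
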